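{- Let $\mathcal M$ be a cubic algebra which has a g-cover, and let $\mathcal L$ be an upwards-closed cubic subalgebra of $\mathcal M$. Then $\mathcal L$ has a g-cover.
   Context: A cubic algebra is a join-semilattice $\mathcal L$ with top $\mathbf 1$ and a binary operation $\Delta$ such that: if $x\le y$ then $\Delta(y,x)\vee x=y$; if $x\le y\le z$ then $\Delta(z,\Delta(y,x))=\Delta(\Delta(z,y),\Delta(z,x))$; if $x\le y$ then $\Delta(y,\Delta(y,x))=x$; if $x\le y\le z$ then $\Delta(z,x)\le\Delta(z,y)$; and with $xy:=\Delta(\mathbf 1,\Delta(x\vee y,y))\vee y$ one has $(xy)y=x\vee y$ and $x(yz)=y(xz)$. A cubic subalgebra is a subset containing $\mathbf 1$ and closed under $\vee$ and $\Delta$. With $xy$, a cubic algebra is an implication algebra; an implication subalgebra is a subset closed under it. $a\sim b$ iff $\Delta(a\vee b,a)=b$; $\mathcal L/\!\sim$ is an implication algebra with $[a]\le[b]$ iff $\Delta(a\vee b,a)\le b$, $[a]\vee[b]=[a\vee\Delta(a\vee b,b)]$, $[a]\to[b]=[\Delta(a\vee b,a)\,b]$. A g-cover is an upwards-closed implication subalgebra $J$ such that the restriction to $J$ of the quotient map $\mathcal L\to\mathcal L/\!\sim$ is an isomorphism of implication algebras. -}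

module Defs where

open import Level using (Level; _⊔_; suc)
open import Algebra.Core using (Op₂)
open import Algebra.Structures using (IsMagma; IsSemigroup; IsBand; IsCommutativeBand)
open import Algebra.Lattice.Structures using (IsJoinSemilattice)
open import Data.Product using (Σ; _×_; _,_; proj₁; proj₂; ∃-syntax)
open import Relation.Binary.Core using (Rel)
open import Relation.Binary.Structures using (IsEquivalence)
open import Relation.Unary using (Pred; _∈_; _⊆_)

module _ {a ℓ} {A : Set a} (_≈_ : Rel A ℓ) (_∨_ : Op₂ A) (𝟏 : A) (Δ : Op₂ A) where

  LeOf : Rel A ℓ
  LeOf x y = (x ∨ y) ≈ y

  ImpOf : Op₂ A
  ImpOf x y = Δ 𝟏 (Δ (x ∨ y) y) ∨ y

  record IsCubicAlgebra : Set (a ⊔ ℓ) where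
    field
      isJoinSemilattice : IsJoinSemilattice _≈_ _∨_
      top    : ∀ x → LeOf x 𝟏
      Δ-cong : ∀ {x x′ y y′} → x ≈ x′ → y ≈ y′ → Δ x y ≈ Δ x′ y′
      ax1 : ∀ {x y} → LeOf x y → (Δ y x ∨ x) ≈ y
      ax2 : ∀ {x y z} → LeOf x y → LeOf y z →
            Δ z (Δ y x) ≈ Δ (Δ z y) (Δ z x)
      ax3 : ∀ {x y} → LeOf x y → Δ y (Δ y x) ≈ x
      ax4 : ∀ {x y z} → LeOf x y → LeOf y z → LeOf (Δ z x) (Δ z y)
      ax5 : ∀ x y → ImpOf (ImpOf x y) y ≈ (x ∨ y)
      ax6 : ∀ x y z → ImpOf x (ImpOf y z) ≈ ImpOf y (ImpOf x z)

record CubicAlgebra (c ℓ : Level) : Set (suc (c ⊔ ℓ)) where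
  infix  4 _≈_ _≤_ _∼_
  infixr 6 _∨_
  field
    Carrier        : Set c
    _≈_            : Rel Carrier ℓ
    _∨_            : Op₂ Carrier
    𝟏              : Carrier
    Δ              : Op₂ Carrier
    isCubicAlgebra : IsCubicAlgebra _≈_ _∨_ 𝟏 Δ

  open IsCubicAlgebra isCubicAlgebra public

  _≤_ : Rel Carrier ℓ
  _≤_ = LeOf _≈_ _∨_ 𝟏 Δ

  _·_ : Op₂ Carrier
  _·_ = ImpOf _≈_ _∨_ 𝟏 Δ

  _∼_ : Rel Carrier ℓ
  a ∼ b = Δ (a ∨ b) a ≈ b

  -- the implication of L/∼ on representatives:  [a] → [b] = [Δ(a ∨ b, a) b]
  _⇒∼_ : Op₂ Carrier
  a ⇒∼ b = Δ (a ∨ b) a · b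

module _ {c ℓ} (M : CubicAlgebra c ℓ) where
  open CubicAlgebra M

  -- J is a subset (closed under ≈), upwards closed, an implication
  -- subalgebra, and the quotient map restricted to J, j ↦ [j], is an
  -- isomorphism of implication algebras J ≅ M/∼ (surjective, injective,
  -- and preserving implication: [j k] = [j] → [k]).
  record IsGCover {p} (J : Pred Carrier p) : Set (c ⊔ ℓ ⊔ p) where
    field
      respects    : ∀ {x y} → x ≈ y → x ∈ J → y ∈ J
      upClosed    : ∀ {x y} → x ∈ J → x ≤ y → y ∈ J
      ·-closed    : ∀ {x y} → x ∈ J → y ∈ J → (x · y) ∈ J
      quot-surj   : ∀ a → ∃[ j ] (j ∈ J × j ∼ a)
      quot-inj    : ∀ {j k} → j ∈ J → k ∈ J → j ∼ k → j ≈ k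
      quot-hom    : ∀ {j k} → j ∈ J → k ∈ J → (j · k) ∼ (j ⇒∼ k)

  HasGCover : (p : Level) → Set (c ⊔ ℓ ⊔ suc p)
  HasGCover p = Σ (Pred Carrier p) IsGCover

  record IsUpClosedCubicSubalgebra {q} (L : Pred Carrier q) : Set (c ⊔ ℓ ⊔ q) where
    field
      respects : ∀ {x y} → x ≈ y → x ∈ L → y ∈ L
      𝟏∈       : 𝟏 ∈ L
      ∨-closed : ∀ {x y} → x ∈ L → y ∈ L → (x ∨ y) ∈ L
      Δ-closed : ∀ {x y} → x ∈ L → y ∈ L → Δ x y ∈ L
      upClosed : ∀ {x y} → x ∈ L → x ≤ y → y ∈ L

  module _ {q} (L : Pred Carrier q) (S : IsUpClosedCubicSubalgebra L) where
    private
      module S = IsUpClosedCubicSubalgebra S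
      module JS = IsJoinSemilattice _≈_ isJoinSemilattice
      C = Σ Carrier L
      _≈ₛ_ : Rel C ℓ
      x ≈ₛ y = proj₁ x ≈ proj₁ y
      _∨ₛ_ : Op₂ C
      (x , px) ∨ₛ (y , py) = (x ∨ y) , S.∨-closed px py
      𝟏ₛ : C
      𝟏ₛ = 𝟏 , S.𝟏∈
      Δₛ : Op₂ C
      Δₛ (x , px) (y , py) = Δ x y , S.Δ-closed px py

      eqₛ : IsEquivalence _≈ₛ_
      eqₛ = record { refl = JS.refl ; sym = JS.sym ; trans = JS.trans }

      jslₛ : IsJoinSemilattice _≈ₛ_ _∨ₛ_
      jslₛ = record
        { isBand = record
          { isSemigroup = record
            { isMagma = record { isEquivalence = eqₛ ; ∙-cong = JS.∨-cong }
            ; assoc = λ x y z → JS.assoc (proj₁ x) (proj₁ y) (proj₁ z) }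
          ; idem = λ x → JS.idem (proj₁ x) }
        ; comm = λ x y → JS.comm (proj₁ x) (proj₁ y) }

    subCubicAlgebra : CubicAlgebra (c ⊔ q) ℓ
    subCubicAlgebra = record
      { Carrier = C ; _≈_ = _≈ₛ_ ; _∨_ = _∨ₛ_ ; 𝟏 = 𝟏ₛ ; Δ = Δₛ
      ; isCubicAlgebra = record
        { isJoinSemilattice = jslₛ
        ; top = λ x → top (proj₁ x)
        ; Δ-cong = Δ-cong
        ; ax1 = ax1 ; ax2 = ax2 ; ax3 = ax3 ; ax4 = ax4
        ; ax5 = λ x y → ax5 (proj₁ x) (proj₁ y)
        ; ax6 = λ x y z → ax6 (proj₁ x) (proj₁ y) (proj₁ z) } }

module Submission where

-- The candidate g-cover of L is J ∩ L.  Upward closure, closure under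
-- the implication and injectivity/homomorphy of the quotient map are
-- inherited verbatim from J, because the operations, the order and the
-- relation ∼ of L are those of M.  The one point with content is
-- surjectivity: for a ∈ L the representative j ∈ J with j ∼ a must lie
-- in L.  This holds because every ∼-class meeting L lies inside L:
-- if j ∼ a then j = Δ(j ∨ a, a) (∼-recover below), and j ∨ a ∈ L by
-- upward closure, so j ∈ L by Δ-closure.

open import Defs
open import Level using (Level; _⊔_; Lift; lift; lower)
open import Relation.Unary using (Pred; _∈_)
open import Data.Product using (Σ; _×_; _,_; proj₁)
open import Algebra.Lattice.Structures using (IsJoinSemilattice)
import Relation.Binary.Reasoning.Setoid as SetoidReasoning

module CubicAlgebraFacts {c ℓ} (M : CubicAlgebra c ℓ) where
  open CubicAlgebra M
  open IsJoinSemilattice _≈_ isJoinSemilattice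
    using (setoid; refl; sym; assoc; comm; idem; ∨-congʳ; ∨-congˡ)
  open SetoidReasoning setoid

  ∨-upperˡ : ∀ x y → x ≤ x ∨ y
  ∨-upperˡ x y = begin
    x ∨ (x ∨ y)  ≈⟨ sym (assoc x x y) ⟩
    (x ∨ x) ∨ y  ≈⟨ ∨-congʳ (idem x) ⟩
    x ∨ y        ∎

  ∨-upperʳ : ∀ x y → y ≤ x ∨ y
  ∨-upperʳ x y = begin
    y ∨ (x ∨ y)  ≈⟨ ∨-congˡ (comm x y) ⟩
    y ∨ (y ∨ x)  ≈⟨ ∨-upperˡ y x ⟩
    y ∨ x        ≈⟨ comm y x ⟩
    x ∨ y        ∎

  -- ∼ can be inverted: if Δ(a ∨ b, a) = b then Δ(a ∨ b, b) = a,
  -- since Δ(y, -) is an involution below y (axiom 3).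
  ∼-recover : ∀ {a b} → a ∼ b → Δ (a ∨ b) b ≈ a
  ∼-recover {a} {b} a∼b = begin
    Δ (a ∨ b) b                ≈⟨ Δ-cong refl (sym a∼b) ⟩
    Δ (a ∨ b) (Δ (a ∨ b) a)    ≈⟨ ax3 (∨-upperˡ a b) ⟩
    a                          ∎

module UpClosedSubalgebraFacts {c ℓ q} (M : CubicAlgebra c ℓ)
  {L : Pred (CubicAlgebra.Carrier M) q} (S : IsUpClosedCubicSubalgebra M L) where
  open CubicAlgebra M
  open CubicAlgebraFacts M
  open IsUpClosedCubicSubalgebra S

  ∼-closed : ∀ {a b} → b ∈ L → a ∼ b → a ∈ L
  ∼-closed {a} {b} b∈L a∼b = respects (∼-recover a∼b) (Δ-closed a∨b∈L b∈L)
    where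
    a∨b∈L : (a ∨ b) ∈ L
    a∨b∈L = upClosed b∈L (∨-upperʳ a b)

restrictGCover : ∀ {c ℓ p q} (M : CubicAlgebra c ℓ) {J : Pred (CubicAlgebra.Carrier M) p}
                 {L : Pred (CubicAlgebra.Carrier M) q} (S : IsUpClosedCubicSubalgebra M L) →
                 IsGCover M J → IsGCover (subCubicAlgebra M L S) (λ x → J (proj₁ x))
restrictGCover M {J} {L} S G = record
  { respects  = G.respects
  ; upClosed  = G.upClosed
  ; ·-closed  = G.·-closed
  ; quot-surj = surjective
  ; quot-inj  = G.quot-inj
  ; quot-hom  = G.quot-hom
  }
  where
  open CubicAlgebra M
  open UpClosedSubalgebraFacts M S
  module G = IsGCover G

  surjective : ∀ (a : Σ Carrier L) →
               Σ (Σ Carrier L) λ j → J (proj₁ j) × proj₁ j ∼ proj₁ a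
  surjective (a , a∈L) with G.quot-surj a
  ... | j , j∈J , j∼a = (j , ∼-closed a∈L j∼a) , j∈J , j∼a

liftGCover : ∀ {c ℓ p} r (M : CubicAlgebra c ℓ) {J : Pred (CubicAlgebra.Carrier M) p} →
             IsGCover M J → IsGCover M (λ x → Lift r (J x))
liftGCover r M G = record
  { respects  = λ x≈y x∈J → lift (G.respects x≈y (lower x∈J))
  ; upClosed  = λ x∈J x≤y → lift (G.upClosed (lower x∈J) x≤y)
  ; ·-closed  = λ x∈J y∈J → lift (G.·-closed (lower x∈J) (lower y∈J))
  ; quot-surj = λ a → let (j , j∈J , j∼a) = G.quot-surj a in j , lift j∈J , j∼a
  ; quot-inj  = λ j∈J k∈J → G.quot-inj (lower j∈J) (lower k∈J)
  ; quot-hom  = λ j∈J k∈J → G.quot-hom (lower j∈J) (lower k∈J)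
  }
  where module G = IsGCover G

corollary6p4 : ∀ {c ℓ p q : Level} (M : CubicAlgebra c ℓ) → HasGCover M p →
                 (L : Pred (CubicAlgebra.Carrier M) q) (S : IsUpClosedCubicSubalgebra M L) →
                 HasGCover (subCubicAlgebra M L S) (c ⊔ ℓ ⊔ p ⊔ q)
corollary6p4 {c} {ℓ} {p} {q} M (J , G) L S =
  (λ x → Lift (c ⊔ ℓ ⊔ q) (J (proj₁ x))) ,
  liftGCover (c ⊔ ℓ ⊔ q) (subCubicAlgebra M L S) (restrictGCover M S G)
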